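{- Let $H$ be a hypergraph, $p\ge1$, and $f\in\mathcal V_p(H)$ with $f_1(v)+\cdots+f_p(v)\ge d_H(v)$ for all $v\in V(H)$. If $H$ is $f$-partitionable, then there is an $f$-partition $(H_1,\dots,H_p)$ of $H$ such that $d_{H_i}(v)\le f_i(v)$ for all $v\in V(H_i)$ and all $i\in\{1,\dots,p\}$.
   Context: A hypergraph $H=(V,E,i)$ consists of finite sets $V(H)$, $E(H)$ and an incidence function $i_H:E\to 2^V$ with $|i(e)|\ge 2$ (parallel edges allowed). $H[X]$ is the subhypergraph with vertex set $X$ and edges $e$ with $i_H(e)\subseteq X$ (induced subhypergraph). The degree $d_G(v)$ is the number of edges of $G$ incident with $v$. For $h:V(H)\to\mathbb N_0$, $H$ is strictly $h$-degenerate if every nonempty subhypergraph $G$ has a vertex $v$ with $d_G(v)<h(v)$. $\mathcal V_p(H)$ is the set of $f=(f_1,\dots,f_p):V(H)\to\mathbb N_0^p$. An $f$-partition is a sequence $(H_1,\dots,H_p)$ of pairwise vertex-disjoint, possibly empty, induced subhypergraphs with $V(H_1)\cup\dots\cup V(H_p)=V(H)$ and each $H_i$ strictly $f_i$-degenerate; $H$ is $f$-partitionable if one exists. -}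

module Defs where

open import Data.Nat using (ℕ; _≤_; _<_)
open import Data.Fin using (Fin)
open import Data.Fin.Subset using (Subset; _∈_; _⊆_; _∩_; ∣_∣; Nonempty; ⊤)
open import Data.Fin.Subset.Properties using (_⊆?_)
open import Data.Vec using (Vec; tabulate; lookup; sum)
open import Data.Product using (Σ; _×_; ∃)
open import Relation.Nullary using (does; ¬_)
open import Data.Empty using (⊥)
open import Relation.Binary.PropositionalEquality using (_≡_)

-- A (finite) hypergraph: vertex set Fin n, edge set Fin m (parallel edges allowed),
-- incidence function inc : E → 2^V with |inc e| ≥ 2.
record Hypergraph : Set where
  field
    n   : ℕ
    m   : ℕ
    inc : Fin m → Subset n
    inc-size : ∀ e → 2 ≤ ∣ inc e ∣

module _ (H : Hypergraph) where
  open Hypergraph H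

  V : Set
  V = Fin n

  incidentEdges : Fin n → Subset m
  incidentEdges v = tabulate (λ e → lookup (inc e) v)

  deg : Subset m → Fin n → ℕ
  deg F v = ∣ F ∩ incidentEdges v ∣

  degH : Fin n → ℕ
  degH = deg ⊤

  inducedEdges : Subset n → Subset m
  inducedEdges X = tabulate (λ e → does (inc e ⊆? X))

  IsSubOfInduced : Subset n → Subset n → Subset m → Set
  IsSubOfInduced X Y F = Y ⊆ X × F ⊆ inducedEdges X × (∀ {e} → e ∈ F → inc e ⊆ Y)

  StrictlyDegenerate : Subset n → (Fin n → ℕ) → Set
  StrictlyDegenerate X h =
    ∀ (Y : Subset n) (F : Subset m) → IsSubOfInduced X Y F → Nonempty Y →
    ∃ λ v → v ∈ Y × deg F v < h v

  -- f-partition (H[Vs 1], …, H[Vs p]) given by vertex sets Vs i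
  IsPartition : (p : ℕ) → (Fin p → Subset n) → Set
  IsPartition p Vs =
    (∀ i j → ¬ (i ≡ j) → ∀ v → v ∈ Vs i → v ∈ Vs j → ⊥)
    × (∀ v → ∃ λ i → v ∈ Vs i)

  IsFPartition : (p : ℕ) → (Fin p → Fin n → ℕ) → (Fin p → Subset n) → Set
  IsFPartition p f Vs = IsPartition p Vs × (∀ i → StrictlyDegenerate (Vs i) (f i))

  FPartitionable : (p : ℕ) → (Fin p → Fin n → ℕ) → Set
  FPartitionable p f = Σ (Fin p → Subset n) (IsFPartition p f)

module Submission where

-- Proposition 3.5.  An f-partition is encoded as a colouring c : V → Fin p
-- whose classes induce strictly fᵢ-degenerate subhypergraphs ("proper"
-- colourings); v is overloaded if its degree in its own class exceeds
-- f_{c(v)}(v).  Every edge at v has a second end of fixed colour, so at most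
-- one class can absorb it when v is moved; hence the degrees v would get in
-- the p classes sum to at most d_H(v) ≤ Σⱼ fⱼ(v), and an overloaded v has a
-- class j giving it degree < fⱼ(v).  Moving v there keeps c proper (a vertex
-- of small degree can be added to a strictly degenerate hypergraph) and
-- strictly lowers the potential
--   #{(e, i) : e lies inside class i} + Σᵤ (Σⱼ fⱼ(u) ∸ f_{c(u)}(u)),
-- so well-founded descent ends at a proper colouring without overloaded
-- vertices.

open import Defs
open import Data.Nat using (ℕ; _≤_)
open import Data.Fin using (Fin)
open import Data.Fin.Subset using (Subset; _∈_)
open import Data.Vec using (tabulate; sum)
open import Data.Product using (Σ; _×_)

open import Data.Bool using (Bool; true; false; _∧_; if_then_else_)
open import Data.Bool.Properties using (∧-comm)
open import Data.Empty using (⊥-elim)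
open import Data.Fin using (zero; suc; punchIn)
open import Data.Fin.Properties using (_≟_; any?; punchInᵢ≢i)
open import Data.Fin.Subset using (⁅_⁆; _∩_; ∣_∣; _⊆_)
open import Data.Fin.Subset.Properties
  using (_∈?_; _⊆?_; ⊆-trans; p⊆q⇒∣p∣≤∣q∣; x∈⁅x⁆; ∣⁅x⁆∣≡1; x∈p∩q⁺; x∈p∩q⁻; ∩-identityˡ)
open import Data.Nat using (zero; suc; _+_; _∸_; _<_; _<?_; z≤n; s≤s)
open import Data.Nat.Induction using (<-wellFounded)
open import Data.Nat.Properties hiding (_≟_)
open import Data.Product using (_,_; proj₁; proj₂; ∃)
open import Data.Sum using (_⊎_; inj₁; inj₂)
open import Data.Vec using (_∷_; lookup)
open import Data.Vec.Properties using (lookup∘tabulate; []=⇒lookup; lookup⇒[]=; tabulate-cong)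
open import Function using (_∘_; case_of_; mk⇔)
open import Induction.WellFounded using (Acc; acc)
open import Relation.Nullary using (Dec; does; yes; no; ¬?; _×-dec_)
open import Relation.Nullary.Decidable using (dec-true; does-⇔)
open import Relation.Binary.PropositionalEquality

open import Algebra.Properties.CommutativeSemigroup +-commutativeSemigroup
  using (interchange)
open import Algebra.Properties.CommutativeMonoid.Sum +-0-commutativeMonoid
  using (sum-remove; sum-cong-≗; ∑-distrib-+; ∑-comm; sum-replicate-zero)
  renaming (sum to ∑)

sum-tabulate : ∀ {k} (a : Fin k → ℕ) → sum (tabulate a) ≡ ∑ a
sum-tabulate {zero}  a = refl
sum-tabulate {suc k} a = cong (a zero +_) (sum-tabulate (a ∘ suc))

∑-mono-≤ : ∀ {k} {a b : Fin k → ℕ} → (∀ x → a x ≤ b x) → ∑ a ≤ ∑ b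
∑-mono-≤ {zero}  a≤b = z≤n
∑-mono-≤ {suc k} a≤b = +-mono-≤ (a≤b zero) (∑-mono-≤ (a≤b ∘ suc))

∑-mono-< : ∀ {k} {a b : Fin k → ℕ} (i : Fin k) →
           (∀ x → a x ≤ b x) → a i < b i → ∑ a < ∑ b
∑-mono-< {suc k} {a} {b} i a≤b aᵢ<bᵢ = begin-strict
  ∑ a                            ≡⟨ sum-remove {i = i} a ⟩
  a i + ∑ (a ∘ punchIn i)        <⟨ +-mono-<-≤ aᵢ<bᵢ (∑-mono-≤ (a≤b ∘ punchIn i)) ⟩
  b i + ∑ (b ∘ punchIn i)        ≡⟨ sum-remove {i = i} b ⟨
  ∑ b                            ∎
  where open ≤-Reasoning

term≤∑ : ∀ {k} (a : Fin k → ℕ) (i : Fin k) → a i ≤ ∑ a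
term≤∑ {suc k} a i = subst (a i ≤_) (sym (sum-remove {i = i} a)) (m≤m+n _ _)

∑-single : ∀ {k} (a : Fin k → ℕ) (w : Fin k) → (∀ x → x ≢ w → a x ≡ 0) → ∑ a ≡ a w
∑-single {suc k} a w vanish = begin
  ∑ a                      ≡⟨ sum-remove {i = w} a ⟩
  a w + ∑ (a ∘ punchIn w)  ≡⟨ cong (a w +_) (sum-cong-≗ (λ x → vanish _ (punchInᵢ≢i w x))) ⟩
  a w + ∑ {k} (λ _ → 0)    ≡⟨ cong (a w +_) (sum-replicate-zero k) ⟩
  a w + 0                  ≡⟨ +-identityʳ (a w) ⟩
  a w                      ∎
  where open ≡-Reasoning

-- Changing one term of a sum: if a and b agree away from v then
-- ∑ a − a v = ∑ b − b v, written without subtraction.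
∑-update : ∀ {k} (a b : Fin k → ℕ) (v : Fin k) → (∀ x → x ≢ v → a x ≡ b x) →
           ∑ a + b v ≡ ∑ b + a v
∑-update {suc k} a b v agree = begin
  ∑ a + b v                      ≡⟨ cong (_+ b v) (sum-remove {i = v} a) ⟩
  (a v + ∑ (a ∘ punchIn v)) + b v ≡⟨ cong (λ s → (a v + s) + b v) rest ⟩
  (a v + ∑ (b ∘ punchIn v)) + b v ≡⟨ +-assoc (a v) _ (b v) ⟩
  a v + (∑ (b ∘ punchIn v) + b v) ≡⟨ +-comm (a v) _ ⟩
  (∑ (b ∘ punchIn v) + b v) + a v ≡⟨ cong (_+ a v) (+-comm _ (b v)) ⟩
  (b v + ∑ (b ∘ punchIn v)) + a v ≡⟨ cong (_+ a v) (sum-remove {i = v} b) ⟨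
  ∑ b + a v                      ∎
  where
  open ≡-Reasoning
  rest : ∑ (a ∘ punchIn v) ≡ ∑ (b ∘ punchIn v)
  rest = sum-cong-≗ (λ x → agree _ (punchInᵢ≢i v x))

𝟙 : Bool → ℕ
𝟙 true  = 1
𝟙 false = 0

𝟙≤1 : ∀ b → 𝟙 b ≤ 1
𝟙≤1 true  = s≤s z≤n
𝟙≤1 false = z≤n

∈-tabulate⁻ : ∀ {k} {g : Fin k → Bool} {x} → x ∈ tabulate g → g x ≡ true
∈-tabulate⁻ {g = g} {x} x∈ = trans (sym (lookup∘tabulate g x)) ([]=⇒lookup x∈)

∈-tabulate⁺ : ∀ {k} {g : Fin k → Bool} {x} → g x ≡ true → x ∈ tabulate g
∈-tabulate⁺ {g = g} {x} gx = lookup⇒[]= x _ (trans (lookup∘tabulate g x) gx)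

module _ {k} {P : Fin k → Set} (P? : ∀ x → Dec (P x)) where

  ∈-filter⁻ : ∀ {x} → x ∈ tabulate (does ∘ P?) → P x
  ∈-filter⁻ {x} x∈ with P? x | ∈-tabulate⁻ {g = does ∘ P?} x∈
  ... | yes Px | _  = Px
  ... | no _   | ()

  ∈-filter⁺ : ∀ {x} → P x → x ∈ tabulate (does ∘ P?)
  ∈-filter⁺ {x} Px = ∈-tabulate⁺ (dec-true (P? x) Px)

∣tabulate∣ : ∀ {k} (g : Fin k → Bool) → ∣ tabulate g ∣ ≡ ∑ (𝟙 ∘ g)
∣tabulate∣ {zero}  g = refl
∣tabulate∣ {suc k} g with g zero
... | true  = cong suc (∣tabulate∣ (g ∘ suc))
... | false = ∣tabulate∣ (g ∘ suc)

tabulate-∩ : ∀ {k} (g h : Fin k → Bool) →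
             tabulate g ∩ tabulate h ≡ tabulate (λ x → g x ∧ h x)
tabulate-∩ {zero}  g h = refl
tabulate-∩ {suc k} g h = cong (g zero ∧ h zero ∷_) (tabulate-∩ (g ∘ suc) (h ∘ suc))

other-element : ∀ {k} (X : Subset k) (v : Fin k) → 2 ≤ ∣ X ∣ → ∃ λ u → u ∈ X × u ≢ v
other-element X v 2≤∣X∣ with any? (λ u → (u ∈? X) ×-dec ¬? (u ≟ v))
... | yes found = found
... | no none = ⊥-elim (<-irrefl refl (≤-trans 2≤∣X∣ ∣X∣≤1))
  where
  X⊆⁅v⁆ : X ⊆ ⁅ v ⁆
  X⊆⁅v⁆ {x} x∈X with x ≟ v
  ... | yes refl = x∈⁅x⁆ v
  ... | no x≢v   = ⊥-elim (none (x , x∈X , x≢v))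
  ∣X∣≤1 : ∣ X ∣ ≤ 1
  ∣X∣≤1 = ≤-trans (p⊆q⇒∣p∣≤∣q∣ X⊆⁅v⁆) (≤-reflexive (∣⁅x⁆∣≡1 v))

module _ (H : Hypergraph) where
  open Hypergraph H

  endᵇ : Fin n → Fin m → Bool
  endᵇ v e = lookup (inc e) v

  endᵇ⁻ : ∀ {v e} → endᵇ v e ≡ true → v ∈ inc e
  endᵇ⁻ {v} {e} = lookup⇒[]= v (inc e)

  endᵇ⁺ : ∀ {v e} → v ∈ inc e → endᵇ v e ≡ true
  endᵇ⁺ = []=⇒lookup

  insideᵇ : Subset n → Fin m → Bool
  insideᵇ X e = does (inc e ⊆? X)

  induced⁻ : ∀ {X e} → e ∈ inducedEdges H X → inc e ⊆ X
  induced⁻ = ∈-filter⁻ (λ e → inc _ ⊆? _)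

  induced⁺ : ∀ {X e} → inc e ⊆ X → e ∈ inducedEdges H X
  induced⁺ = ∈-filter⁺ (λ e → inc _ ⊆? _)

  deg-induced : ∀ X v → deg H (inducedEdges H X) v ≡ ∑ (λ e → 𝟙 (endᵇ v e ∧ insideᵇ X e))
  deg-induced X v = begin
    ∣ tabulate (insideᵇ X) ∩ tabulate (endᵇ v) ∣
      ≡⟨ cong ∣_∣ (tabulate-∩ (insideᵇ X) (endᵇ v)) ⟩
    ∣ tabulate (λ e → insideᵇ X e ∧ endᵇ v e) ∣
      ≡⟨ ∣tabulate∣ (λ e → insideᵇ X e ∧ endᵇ v e) ⟩
    ∑ (λ e → 𝟙 (insideᵇ X e ∧ endᵇ v e))
      ≡⟨ sum-cong-≗ {m} (λ e → cong 𝟙 (∧-comm (insideᵇ X e) (endᵇ v e))) ⟩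
    ∑ (λ e → 𝟙 (endᵇ v e ∧ insideᵇ X e)) ∎
    where open ≡-Reasoning

  degH-count : ∀ v → degH H v ≡ ∑ (𝟙 ∘ endᵇ v)
  degH-count v = trans (cong ∣_∣ (∩-identityˡ (incidentEdges H v))) (∣tabulate∣ (endᵇ v))

  deg-⊆ : ∀ {F G} v → F ⊆ G → deg H F v ≤ deg H G v
  deg-⊆ {F} v F⊆G = p⊆q⇒∣p∣≤∣q∣ λ x∈ →
    let (x∈F , x∋v) = x∈p∩q⁻ F _ x∈ in x∈p∩q⁺ (F⊆G x∈F , x∋v)

  degenerate-⊆ : ∀ {X X'} h → X' ⊆ X → StrictlyDegenerate H X h → StrictlyDegenerate H X' h
  degenerate-⊆ {X} {X'} h X'⊆X sd Y F (Y⊆X' , F⊆ , ends⊆Y) =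
    sd Y F (⊆-trans Y⊆X' X'⊆X ,
            (λ e∈F → induced⁺ (⊆-trans (induced⁻ (F⊆ e∈F)) X'⊆X)) ,
            ends⊆Y)

  degenerate-extend : ∀ {X X'} h v → (∀ {u} → u ∈ X' → u ∈ X ⊎ u ≡ v) →
                      (v ∈ X' → deg H (inducedEdges H X') v < h v) →
                      StrictlyDegenerate H X h → StrictlyDegenerate H X' h
  degenerate-extend {X} {X'} h v X'⊆X+v small sd Y F (Y⊆X' , F⊆ , ends⊆Y) Y≠∅ with v ∈? Y
  ... | yes v∈Y = v , v∈Y , ≤-<-trans (deg-⊆ v F⊆) (small (Y⊆X' v∈Y))
  ... | no v∉Y  = sd Y F (Y⊆X , (λ e∈F → induced⁺ (⊆-trans (ends⊆Y e∈F) Y⊆X)) , ends⊆Y) Y≠∅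
    where
    Y⊆X : Y ⊆ X
    Y⊆X u∈Y with X'⊆X+v (Y⊆X' u∈Y)
    ... | inj₁ u∈X  = u∈X
    ... | inj₂ refl = ⊥-elim (v∉Y u∈Y)

  other-end : ∀ e v → ∃ λ u → u ∈ inc e × u ≢ v
  other-end e v = other-element (inc e) v (inc-size e)

module _ {n p : ℕ} where

  class : (Fin n → Fin p) → Fin p → Subset n
  class c k = tabulate (λ u → does (c u ≟ k))

  ∈class⁻ : ∀ c {k u} → u ∈ class c k → c u ≡ k
  ∈class⁻ c {k} = ∈-filter⁻ (λ u → c u ≟ k)

  ∈class⁺ : ∀ c {k u} → c u ≡ k → u ∈ class c k
  ∈class⁺ c {k} = ∈-filter⁺ (λ u → c u ≟ k)

  class-cong : ∀ {c c'} → (∀ u → c u ≡ c' u) → ∀ k → class c k ≡ class c' k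
  class-cong c≗c' k = tabulate-cong (λ u → cong (λ x → does (x ≟ k)) (c≗c' u))

  recolour : (Fin n → Fin p) → Fin n → Fin p → Fin n → Fin p
  recolour c v j u = if does (u ≟ v) then j else c u

  recolour-at : ∀ c v j → recolour c v j v ≡ j
  recolour-at c v j with v ≟ v
  ... | yes _   = refl
  ... | no v≢v  = ⊥-elim (v≢v refl)

  recolour-away : ∀ c v j u → u ≢ v → recolour c v j u ≡ c u
  recolour-away c v j u u≢v with u ≟ v
  ... | yes u≡v = ⊥-elim (u≢v u≡v)
  ... | no _    = refl

  recolour-self : ∀ c v u → recolour c v (c v) u ≡ c u
  recolour-self c v u with u ≟ v
  ... | yes refl = refl
  ... | no _     = refl

class-partition : (H : Hypergraph) (p : ℕ) (c : Fin (Hypergraph.n H) → Fin p) →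
                  IsPartition H p (class c)
class-partition H p c =
  (λ i j i≢j u u∈i u∈j → i≢j (trans (sym (∈class⁻ c u∈i)) (∈class⁻ c u∈j))) ,
  (λ u → c u , ∈class⁺ c refl)

module Recolouring (H : Hypergraph) (p : ℕ) (f : Fin p → Fin (Hypergraph.n H) → ℕ) where
  open Hypergraph H

  Colouring : Set
  Colouring = Fin n → Fin p

  capacity : Fin n → ℕ
  capacity u = ∑ (λ k → f k u)

  Proper : Colouring → Set
  Proper c = ∀ k → StrictlyDegenerate H (class c k) (f k)

  ownDegree : Colouring → Fin n → ℕ
  ownDegree c v = deg H (inducedEdges H (class c (c v))) v

  movedDegree : Colouring → Fin n → Fin p → ℕ
  movedDegree c v j = deg H (inducedEdges H (class (recolour c v j) j)) v

  -- The potential: edges lying inside a class (counted with the number of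
  -- classes containing them, which is at most one) plus unused capacity.
  classesContaining : Colouring → Fin m → ℕ
  classesContaining c e = ∑ (λ k → 𝟙 (insideᵇ H (class c k) e))

  slack : Fin p → Fin n → ℕ
  slack k u = capacity u ∸ f k u

  potential : Colouring → ℕ
  potential c = ∑ (classesContaining c) + ∑ (λ u → slack (c u) u)

  slack-split : ∀ k u → f k u + slack k u ≡ capacity u
  slack-split k u = m+[n∸m]≡n (term≤∑ (λ i → f i u) k)

  classes-through : ∀ c v e → endᵇ H v e ≡ true →
                    classesContaining c e ≡ 𝟙 (insideᵇ H (class c (c v)) e)
  classes-through c v e v∈e = ∑-single _ (c v) outside
    where
    outside : ∀ k → k ≢ c v → 𝟙 (insideᵇ H (class c k) e) ≡ 0
    outside k k≢cv with inc e ⊆? class c k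
    ... | yes e⊆k = ⊥-elim (k≢cv (sym (∈class⁻ c (e⊆k (endᵇ⁻ H v∈e)))))
    ... | no _    = refl

  classes-avoiding : ∀ c c' e → (∀ u → u ∈ inc e → c u ≡ c' u) →
                     classesContaining c e ≡ classesContaining c' e
  classes-avoiding c c' e agree = sum-cong-≗ λ k →
    cong 𝟙 (does-⇔ (mk⇔ (transport agree) (transport (λ u u∈e → sym (agree u u∈e))))
                   (inc e ⊆? class c k) (inc e ⊆? class c' k))
    where
    transport : ∀ {c c' k} → (∀ u → u ∈ inc e → c u ≡ c' u) →
                inc e ⊆ class c k → inc e ⊆ class c' k
    transport {c} {c'} agree e⊆k {u} u∈e =
      ∈class⁺ c' (trans (sym (agree u u∈e)) (∈class⁻ c (e⊆k u∈e)))

  edges-balance : ∀ c c' v → (∀ u → u ≢ v → c u ≡ c' u) →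
                  ∑ (classesContaining c) + ownDegree c' v ≡
                  ∑ (classesContaining c') + ownDegree c v
  edges-balance c c' v agree = begin
    ∑ (classesContaining c) + ownDegree c' v
      ≡⟨ cong (_ +_) (deg-induced H (class c' (c' v)) v) ⟩
    ∑ (classesContaining c) + ∑ (own c')
      ≡⟨ ∑-distrib-+ (classesContaining c) (own c') ⟨
    ∑ (λ e → classesContaining c e + own c' e)
      ≡⟨ sum-cong-≗ per-edge ⟩
    ∑ (λ e → classesContaining c' e + own c e)
      ≡⟨ ∑-distrib-+ (classesContaining c') (own c) ⟩
    ∑ (classesContaining c') + ∑ (own c)
      ≡⟨ cong (_ +_) (deg-induced H (class c (c v)) v) ⟨
    ∑ (classesContaining c') + ownDegree c v ∎
    where
    open ≡-Reasoning
    own : Colouring → Fin m → ℕ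
    own d e = 𝟙 (endᵇ H v e ∧ insideᵇ H (class d (d v)) e)
    per-edge : ∀ e → classesContaining c e + own c' e ≡ classesContaining c' e + own c e
    per-edge e with endᵇ H v e in v∈e?
    ... | true  rewrite classes-through c v e v∈e? | classes-through c' v e v∈e? =
      +-comm (𝟙 (insideᵇ H (class c (c v)) e)) _
    ... | false = cong (_+ 0) (classes-avoiding c c' e away)
      where
      away : ∀ u → u ∈ inc e → c u ≡ c' u
      away u u∈e = agree u λ { refl → case trans (sym v∈e?) (endᵇ⁺ H u∈e) of λ () }

  -- An edge at v lies in at most one class after moving v, so the degrees v
  -- would get in the various classes sum to at most d_H(v).
  moved-sum : ∀ c v → ∑ (movedDegree c v) ≤ degH H v
  moved-sum c v = begin
    ∑ (movedDegree c v)             ≡⟨ sum-cong-≗ (λ j → deg-induced H (class (recolour c v j) j) v) ⟩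
    ∑ (λ j → ∑ (λ e → moved j e))   ≡⟨ ∑-comm moved ⟩
    ∑ (λ e → ∑ (λ j → moved j e))   ≤⟨ ∑-mono-≤ per-edge ⟩
    ∑ (𝟙 ∘ endᵇ H v)                ≡⟨ degH-count H v ⟨
    degH H v                        ∎
    where
    open ≤-Reasoning
    moved : Fin p → Fin m → ℕ
    moved j e = 𝟙 (endᵇ H v e ∧ insideᵇ H (class (recolour c v j) j) e)
    -- Only j = c u works, u being an end of e other than v.
    per-edge : ∀ e → ∑ (λ j → moved j e) ≤ 𝟙 (endᵇ H v e)
    per-edge e with endᵇ H v e
    ... | false = ≤-reflexive (sum-replicate-zero p)
    ... | true with other-end H e v
    ...   | u , u∈e , u≢v = ≤-trans (≤-reflexive (∑-single _ (c u) only)) (𝟙≤1 _)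
      where
      only : ∀ j → j ≢ c u → 𝟙 (insideᵇ H (class (recolour c v j) j) e) ≡ 0
      only j j≢cu with inc e ⊆? class (recolour c v j) j
      ... | yes e⊆j = ⊥-elim (j≢cu (trans (sym (∈class⁻ (recolour c v j) (e⊆j u∈e)))
                                          (recolour-away c v j u u≢v)))
      ... | no _    = refl

  moved-own : ∀ c v → movedDegree c v (c v) ≡ ownDegree c v
  moved-own c v = cong (λ X → deg H (inducedEdges H X) v) (class-cong (recolour-self c v) (c v))

  better-class : ∀ c v → degH H v ≤ capacity v → f (c v) v < ownDegree c v →
                 ∃ λ j → movedDegree c v j < f j v
  better-class c v deg≤cap overloaded with any? (λ j → movedDegree c v j <? f j v)
  ... | yes found = found
  ... | no none   = ⊥-elim (<-irrefl refl (begin-strict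
    capacity v             <⟨ ∑-mono-< (c v) (λ j → ≮⇒≥ (λ lt → none (j , lt)))
                                 (subst (f (c v) v <_) (sym (moved-own c v)) overloaded) ⟩
    ∑ (movedDegree c v)    ≤⟨ moved-sum c v ⟩
    degH H v               ≤⟨ deg≤cap ⟩
    capacity v             ∎))
    where open ≤-Reasoning

  recolour-proper : ∀ c v j → movedDegree c v j < f j v → Proper c → Proper (recolour c v j)
  recolour-proper c v j fits proper k = degenerate-extend H (f k) v ⊆old+v small (proper k)
    where
    ⊆old+v : ∀ {u} → u ∈ class (recolour c v j) k → u ∈ class c k ⊎ u ≡ v
    ⊆old+v {u} u∈k with u ≟ v
    ... | yes u≡v = inj₂ u≡v
    ... | no u≢v  = inj₁ (∈class⁺ c (trans (sym (recolour-away c v j u u≢v))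
                                           (∈class⁻ (recolour c v j) u∈k)))
    small : v ∈ class (recolour c v j) k →
            deg H (inducedEdges H (class (recolour c v j) k)) v < f k v
    small v∈k = subst (λ k → deg H (inducedEdges H (class (recolour c v j) k)) v < f k v)
                      (trans (sym (recolour-at c v j)) (∈class⁻ (recolour c v j) v∈k)) fits

  -- Moving an overloaded v to a class where it fits lowers the potential:
  -- the edge count changes by movedDegree − ownDegree < f j v − f (c v) v,
  -- and the slack changes by exactly f (c v) v − f j v.
  potential-decrease : ∀ c v j → f (c v) v < ownDegree c v → movedDegree c v j < f j v →
                       potential (recolour c v j) < potential c
  potential-decrease c v j overloaded fits =
    +-cancelʳ-< _ (potential (recolour c v j)) (potential c) (begin-strict
      potential c' + (d' + sⱼ)  <⟨ +-monoʳ-< (potential c') local-gain ⟩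
      potential c' + (d + sᵢ)   ≡⟨ balance ⟩
      potential c + (d' + sⱼ)   ∎)
    where
    open ≤-Reasoning
    c' : Colouring
    c' = recolour c v j
    d d' sᵢ sⱼ M M' G G' : ℕ
    d  = ownDegree c v
    d' = movedDegree c v j
    sᵢ = slack (c v) v
    sⱼ = slack j v
    M  = ∑ (classesContaining c)
    M' = ∑ (classesContaining c')
    G  = ∑ (λ u → slack (c u) u)
    G' = ∑ (λ u → slack (c' u) u)
    agree : ∀ u → u ≢ v → c u ≡ c' u
    agree u u≢v = sym (recolour-away c v j u u≢v)
    edges : M + d' ≡ M' + d
    edges = subst (λ x → M + x ≡ M' + d)
                  (cong (λ k → deg H (inducedEdges H (class c' k)) v) (recolour-at c v j))
                  (edges-balance c c' v agree)
    slacks : G + sⱼ ≡ G' + sᵢ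
    slacks = subst (λ k → G + slack k v ≡ G' + sᵢ) (recolour-at c v j)
                   (∑-update _ _ v (λ u u≢v → cong (λ k → slack k u) (agree u u≢v)))
    local-gain : d' + sⱼ < d + sᵢ
    local-gain = begin-strict
      d' + sⱼ         <⟨ +-monoˡ-< sⱼ fits ⟩
      f j v + sⱼ      ≡⟨ trans (slack-split j v) (sym (slack-split (c v) v)) ⟩
      f (c v) v + sᵢ  <⟨ +-monoˡ-< sᵢ overloaded ⟩
      d + sᵢ          ∎
    balance : potential c' + (d + sᵢ) ≡ potential c + (d' + sⱼ)
    balance = begin-equality
      (M' + G') + (d + sᵢ)  ≡⟨ interchange M' G' d sᵢ ⟩
      (M' + d) + (G' + sᵢ)  ≡⟨ cong₂ _+_ edges slacks ⟨
      (M + d') + (G + sⱼ)   ≡⟨ interchange M d' G sⱼ ⟩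
      (M + G) + (d' + sⱼ)   ∎

  Balanced : Colouring → Set
  Balanced c = ∀ u → ownDegree c u ≤ f (c u) u

  descend : (∀ v → degH H v ≤ capacity v) →
            ∀ c → Acc _<_ (potential c) → Proper c → Σ Colouring λ c' → Proper c' × Balanced c'
  descend deg≤cap c (acc smaller) proper with any? (λ v → f (c v) v <? ownDegree c v)
  ... | no none = c , proper , λ u → ≮⇒≥ (λ overloaded → none (u , overloaded))
  ... | yes (v , overloaded) with better-class c v (deg≤cap v) overloaded
  ...   | j , fits = descend deg≤cap (recolour c v j)
                       (smaller (potential-decrease c v j overloaded fits))
                       (recolour-proper c v j fits proper)

proposition3p5 : (H : Hypergraph) (p : ℕ) → 1 ≤ p →
    (f : Fin p → Fin (Hypergraph.n H) → ℕ) →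
    (∀ v → degH H v ≤ sum (tabulate (λ i → f i v))) →
    FPartitionable H p f →
    Σ (Fin p → Subset (Hypergraph.n H)) λ Vs →
    IsFPartition H p f Vs ×
    (∀ i v → v ∈ Vs i → deg H (inducedEdges H (Vs i)) v ≤ f i v)
proposition3p5 H p _ f deg≤sum (Vs , (_ , cover) , degenerate) =
  class c' , (class-partition H p c' , proper') , balanced
  where
  open Recolouring H p f
  -- Colour each vertex by a part containing it; classes lie inside the parts.
  c : Colouring
  c u = proj₁ (cover u)
  proper : Proper c
  proper k = degenerate-⊆ H (f k)
               (λ {u} u∈k → subst (λ i → u ∈ Vs i) (∈class⁻ c u∈k) (proj₂ (cover u)))
               (degenerate k)
  deg≤cap : ∀ v → degH H v ≤ capacity v
  deg≤cap v = subst (degH H v ≤_) (sum-tabulate (λ i → f i v)) (deg≤sum v)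
  result : Σ Colouring λ c' → Proper c' × Balanced c'
  result = descend deg≤cap c (<-wellFounded (potential c)) proper
  c' : Colouring
  c' = proj₁ result
  proper' : Proper c'
  proper' = proj₁ (proj₂ result)
  balanced : ∀ i v → v ∈ class c' i → deg H (inducedEdges H (class c' i)) v ≤ f i v
  balanced i v v∈i = subst (λ k → deg H (inducedEdges H (class c' k)) v ≤ f k v)
                           (∈class⁻ c' v∈i) (proj₂ (proj₂ result) v)
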